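{- Let $p$ be an odd prime and for $k\ge1$ let $S_k=\sum_{a=1}^{(p-1)/2}a^k$. Then (i) $\displaystyle S_1+S_3+\dots+S_{p-2}=\sum_{\substack{j=1\\ j\text{ odd}}}^{p-2}\ \sum_{a=1}^{(p-1)/2}a^j\equiv-\frac12\pmod p$; (ii) $\displaystyle\sum_{\substack{j=1\\ j\text{ odd}}}^{p-2}\ \sum_{a=(p+1)/2}^{p-1}a^j\equiv\frac12\pmod p$.
   Context: Congruences are taken in $\mathbb{Z}_p$. -}

module Defs where

open import Data.Nat using (ℕ; zero; suc; _+_; _*_; _∸_; _^_; _/_; _%_; _≟_)
open import Data.List using (List; map; upTo; filter)
open import Data.Nat.ListAction using (sum)

-- ∑_{a = lo}^{hi} f a   (empty if hi < lo)
sumFromTo : ℕ → ℕ → (ℕ → ℕ) → ℕ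
sumFromTo lo hi f = sum (map (λ i → f (lo + i)) (upTo (suc hi ∸ lo)))

sumOdd : ℕ → (ℕ → ℕ) → ℕ
sumOdd hi f = sum (map f (filter (λ j → j % 2 ≟ 1) (upTo (suc hi))))

S : ℕ → ℕ → ℕ
S p k = sumFromTo 1 ((p ∸ 1) / 2) (λ a → a ^ k)

T : ℕ → ℕ → ℕ
T p k = sumFromTo ((p + 1) / 2) (p ∸ 1) (λ a → a ^ k)

module Submission where

-- Let p = 2n + 1 be an odd prime.  Both congruences come from evaluating the
-- double sum over a and over odd j ≤ p − 2 in the other order: for a fixed base x,
--   X n x = x + x³ + ⋯ + x^(2n−1)
-- satisfies the geometric-series identity x²·X n x + x = X n x + x^p.  By Fermat's
-- little theorem x^p ≡ x, so (x² − 1)·X n x ≡ 0, and X n x ≡ 0 whenever x ≢ ±1,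
-- i.e. for 2 ≤ x ≤ p − 2.  Hence only the extreme bases survive:
--   (i)  the bases 1..n contribute only X n 1 = n ≡ −1/2;
--   (ii) the bases n+1..2n contribute only X n (p − 1) ≡ −n ≡ 1/2.
-- The file first proves p ∣ C(p,k) and Fermat's little theorem (via the library's
-- binomial theorem), then the facts about X n x, then rewrites the list sums of
-- Defs as sums over Fin, and finally transfers the two congruences to ℤ.

module PowerSums where

  open import Data.Nat
  open import Data.Nat.Properties
  open import Data.Nat.Divisibility
  open import Data.Nat.DivMod using (_/_; _%_; m*n/n≡m; m*n%n≡0; [m+kn]%n≡m%n)
  open import Data.Nat.Primality using (Prime; euclidsLemma; prime⇒irreducible; ¬prime[0]; ¬prime[1])
  open import Data.Nat.Coprimality using (coprime-divisor; prime⇒coprime)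
  open import Data.Nat.Combinatorics using (_C_; nC1≡n; nCn≡1; nCk+nC[k+1]≡[n+1]C[k+1])
  open import Data.Nat.Combinatorics.Specification using (k>n⇒nCk≡0)
  open import Data.Nat.ListAction using () renaming (sum to listSum)
  open import Data.Nat.Tactic.RingSolver using (solve-∀)
  open import Data.Fin.Base using (Fin; toℕ; fromℕ; inject₁) renaming (zero to fzero; suc to fsuc)
  open import Data.Fin.Properties using (toℕ-fromℕ; toℕ-inject₁; toℕ<n)
  open import Data.Vec.Functional using (Vector; init; last; tail)
  open import Data.List.Base using (List; _∷_; map; applyUpTo; filter)
  open import Relation.Nullary using (Dec)
  open import Data.List.Properties using (filter-accept; filter-reject)
  open import Data.Product using (∃-syntax; _,_)
  open import Data.Sum using (_⊎_; inj₁; inj₂)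
  open import Data.Empty using (⊥-elim)
  open import Function.Base using (_∘_; id)
  open import Relation.Binary.PropositionalEquality
  open import Defs
  open import Algebra.Properties.CommutativeMonoid.Sum +-0-commutativeMonoid
    using (sum; sum-syntax; sum-cong-≗; sum-init-last; ∑-distrib-+; ∑-comm)
  open import Algebra.Properties.Semiring.Sum +-*-semiring using (*-distribˡ-sum)
  open import Algebra.Properties.CommutativeSemiring.Binomial +-*-commutativeSemiring
    using (binomialTerm) renaming (theorem to binomialTheorem)
  import Algebra.Properties.Semiring.Exp +-*-semiring as SemiringExp
  import Algebra.Properties.Semiring.Mult +-*-semiring as SemiringMult

  C-absorption : ∀ n k → suc k * (suc n C suc k) ≡ suc n * (n C k)
  C-absorption zero zero = refl
  C-absorption zero (suc k) = begin
    suc (suc k) * (1 C suc (suc k)) ≡⟨ cong (suc (suc k) *_) (k>n⇒nCk≡0 {1} {suc (suc k)} (s<s z<s)) ⟩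
    suc (suc k) * 0                ≡⟨ *-zeroʳ (suc (suc k)) ⟩
    0                              ≡⟨ cong (1 *_) (k>n⇒nCk≡0 {0} {suc k} z<s) ⟨
    1 * (0 C suc k)                ∎
    where open ≡-Reasoning
  C-absorption (suc n) zero = begin
    1 * (suc (suc n) C 1)     ≡⟨ *-identityˡ _ ⟩
    suc (suc n) C 1           ≡⟨ nC1≡n (suc (suc n)) ⟩
    suc (suc n)               ≡⟨ *-identityʳ (suc (suc n)) ⟨
    suc (suc n) * (suc n C 0) ∎
    where open ≡-Reasoning
  C-absorption (suc n) (suc k) = begin
    suc (suc k) * (suc (suc n) C suc (suc k))
      ≡⟨ cong (suc (suc k) *_) (nCk+nC[k+1]≡[n+1]C[k+1] (suc n) (suc k)) ⟨
    suc (suc k) * (A + B)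
      ≡⟨ split-left k A B ⟩
    (suc k * A + A) + suc (suc k) * B
      ≡⟨ cong₂ (λ u v → u + A + v) (C-absorption n k) (C-absorption n (suc k)) ⟩
    (suc n * (n C k) + A) + suc n * (n C suc k)
      ≡⟨ cong (λ u → suc n * (n C k) + u + suc n * (n C suc k)) (nCk+nC[k+1]≡[n+1]C[k+1] n k) ⟨
    (suc n * (n C k) + (n C k + n C suc k)) + suc n * (n C suc k)
      ≡⟨ merge n (n C k) (n C suc k) ⟩
    suc (suc n) * (n C k + n C suc k)
      ≡⟨ cong (suc (suc n) *_) (nCk+nC[k+1]≡[n+1]C[k+1] n k) ⟩
    suc (suc n) * (suc n C suc k) ∎
    where
    open ≡-Reasoning
    A = suc n C suc k
    B = suc n C suc (suc k)
    split-left : ∀ k a b → suc (suc k) * (a + b) ≡ (suc k * a + a) + suc (suc k) * b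
    split-left = solve-∀
    merge : ∀ n a b → (suc n * a + (a + b)) + suc n * b ≡ suc (suc n) * (a + b)
    merge = solve-∀

  prime∣C : ∀ {p k} → Prime p → 0 < k → k < p → p ∣ p C k
  prime∣C {suc r} {suc j} pr _ k<p
    with euclidsLemma (suc j) (suc r C suc j) pr (subst (suc r ∣_) (sym (C-absorption r j)) (m∣m*n (r C j)))
  ... | inj₁ p∣k = ⊥-elim (<⇒≱ k<p (∣⇒≤ p∣k))
  ... | inj₂ p∣C = p∣C

  ^-semiring : ∀ x n → x SemiringExp.^ n ≡ x ^ n
  ^-semiring x zero = refl
  ^-semiring x (suc n) = cong (x *_) (^-semiring x n)

  ×-semiring : ∀ n x → n SemiringMult.× x ≡ n * x
  ×-semiring zero x = refl
  ×-semiring (suc n) x = cong (x +_) (×-semiring n x)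

  ∣-sum : ∀ {d n} (f : Vector ℕ n) → (∀ i → d ∣ f i) → d ∣ sum f
  ∣-sum {d} {zero} f d∣f = d ∣0
  ∣-sum {n = suc n} f d∣f = ∣m∣n⇒∣m+n (d∣f fzero) (∣-sum (tail f) (d∣f ∘ fsuc))

  ∑-ones : ∀ n → ∑[ i < n ] 1 ≡ n
  ∑-ones zero = refl
  ∑-ones (suc n) = cong suc (∑-ones n)

  freshman : ∀ {p} → Prime p → ∀ a → ∃[ q ] suc a ^ p ≡ suc (a ^ p) + q * p
  freshman {p@(suc r)} pr a = quotient middle∣ , (begin
      suc a ^ p                       ≡⟨ ^-semiring (suc a) p ⟨
      suc a SemiringExp.^ p           ≡⟨ binomialTheorem p 1 a ⟩
      term fzero + sum (tail term)    ≡⟨ cong (term fzero +_) (sum-init-last (tail term)) ⟩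
      term fzero + (middle + last (tail term))
        ≡⟨ cong₂ (λ u v → term fzero + (u + v)) (m∣n⇒n≡quotient*m middle∣) term-last ⟩
      term fzero + (quotient middle∣ * p + 1)
        ≡⟨ cong (λ u → u + (quotient middle∣ * p + 1)) term-first ⟩
      a ^ p + (quotient middle∣ * p + 1)
        ≡⟨ rearrange (a ^ p) (quotient middle∣ * p) ⟩
      suc (a ^ p) + quotient middle∣ * p ∎)
    where
    open ≡-Reasoning
    term : Vector ℕ (suc p)
    term = binomialTerm 1 a p
    term-formula : ∀ k → term k ≡ (p C toℕ k) * a ^ (p ∸ toℕ k)
    term-formula k = begin
      (p C toℕ k) SemiringMult.× (1 SemiringExp.^ toℕ k * a SemiringExp.^ (p ∸ toℕ k))
        ≡⟨ ×-semiring (p C toℕ k) _ ⟩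
      (p C toℕ k) * (1 SemiringExp.^ toℕ k * a SemiringExp.^ (p ∸ toℕ k))
        ≡⟨ cong₂ (λ u v → (p C toℕ k) * (u * v)) (trans (^-semiring 1 (toℕ k)) (^-zeroˡ (toℕ k))) (^-semiring a (p ∸ toℕ k)) ⟩
      (p C toℕ k) * (1 * a ^ (p ∸ toℕ k))
        ≡⟨ cong ((p C toℕ k) *_) (*-identityˡ _) ⟩
      (p C toℕ k) * a ^ (p ∸ toℕ k) ∎
    term-first : term fzero ≡ a ^ p
    term-first = trans (term-formula fzero) (*-identityˡ (a ^ p))
    term-last : last (tail term) ≡ 1
    term-last = begin
      term (fromℕ p)                                 ≡⟨ term-formula (fromℕ p) ⟩
      (p C toℕ (fromℕ p)) * a ^ (p ∸ toℕ (fromℕ p))  ≡⟨ cong (λ k → (p C k) * a ^ (p ∸ k)) (toℕ-fromℕ p) ⟩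
      (p C p) * a ^ (p ∸ p)                          ≡⟨ cong₂ (λ u v → u * a ^ v) (nCn≡1 p) (n∸n≡0 p) ⟩
      1                                              ∎
    middle : ℕ
    middle = sum (init (tail term))
    middle∣ : p ∣ middle
    middle∣ = ∣-sum (init (tail term)) λ i → subst (p ∣_) (sym (term-formula (fsuc (inject₁ i))))
      (∣m⇒∣m*n _ (prime∣C pr z<s (s<s (subst (_< r) (sym (toℕ-inject₁ i)) (toℕ<n i)))))
    rearrange : ∀ x y → x + (y + 1) ≡ suc x + y
    rearrange = solve-∀

  fermat : ∀ {p} → Prime p → ∀ a → ∃[ q ] a ^ p ≡ a + q * p
  fermat {suc r} pr zero = 0 , refl
  fermat {p} pr (suc a) with fermat pr a | freshman pr a
  ... | q , a^p≡ | q′ , [1+a]^p≡ = q′ + q , (begin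
    suc a ^ p                    ≡⟨ [1+a]^p≡ ⟩
    suc (a ^ p) + q′ * p         ≡⟨ cong (λ u → suc u + q′ * p) a^p≡ ⟩
    suc (a + q * p) + q′ * p     ≡⟨ regroup a q q′ p ⟩
    suc a + (q′ + q) * p         ∎)
    where
    open ≡-Reasoning
    regroup : ∀ a q q′ p → suc (a + q * p) + q′ * p ≡ suc a + (q′ + q) * p
    regroup = solve-∀

  -- Doubling, so that p = suc (double n) is an odd number with p ∸ 2 reducing.
  double : ℕ → ℕ
  double zero = 0
  double (suc n) = suc (suc (double n))

  double-* : ∀ n → double n ≡ n * 2
  double-* zero = refl
  double-* (suc n) = cong (suc ∘ suc) (double-* n)

  double-+ : ∀ n → double n ≡ n + n
  double-+ zero = refl
  double-+ (suc n) = cong suc (trans (cong suc (double-+ n)) (sym (+-suc n n)))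

  even-or-odd : ∀ k → ∃[ m ] (k ≡ double m ⊎ k ≡ suc (double m))
  even-or-odd zero = 0 , inj₁ refl
  even-or-odd (suc k) with even-or-odd k
  ... | m , inj₁ k≡2m = m , inj₂ (cong suc k≡2m)
  ... | m , inj₂ k≡2m+1 = suc m , inj₁ (cong suc k≡2m+1)

  odd-prime : ∀ {p} → Prime p → p ≢ 2 → ∃[ m ] p ≡ suc (double (suc m))
  odd-prime {p} pr p≢2 with even-or-odd p
  ... | zero , inj₁ refl = ⊥-elim (¬prime[0] pr)
  ... | suc m , inj₁ refl with prime⇒irreducible pr (divides (suc m) (double-* (suc m)))
  ...   | inj₁ ()
  ...   | inj₂ 2≡p = ⊥-elim (p≢2 (sym 2≡p))
  odd-prime pr p≢2 | zero , inj₂ refl = ⊥-elim (¬prime[1] pr)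
  odd-prime pr p≢2 | suc m , inj₂ refl = m , refl

  oddPowerSum : ℕ → ℕ → ℕ
  oddPowerSum n x = ∑[ i < n ] (x ^ suc (double (toℕ i)))

  oddPowerSum-suc : ∀ n x → oddPowerSum (suc n) x ≡ x + x * (x * oddPowerSum n x)
  oddPowerSum-suc n x = cong₂ _+_ (*-identityʳ x) (sym (begin
    x * (x * oddPowerSum n x)                         ≡⟨ cong (x *_) (*-distribˡ-sum x term) ⟩
    x * ∑[ i < n ] (x * x ^ suc (double (toℕ i)))     ≡⟨ *-distribˡ-sum x (λ i → x * term i) ⟩
    ∑[ i < n ] (x * (x * x ^ suc (double (toℕ i))))   ∎))
    where
    open ≡-Reasoning
    term : Vector ℕ n
    term i = x ^ suc (double (toℕ i))

  geometric : ∀ n x → x * (x * oddPowerSum n x) + x ≡ oddPowerSum n x + x ^ suc (double n)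
  geometric zero x = base x
    where
    base : ∀ x → x * (x * 0) + x ≡ 0 + x * 1
    base = solve-∀
  geometric (suc n) x = begin
    x * (x * X′) + x                 ≡⟨ cong (λ u → x * (x * u) + x) (oddPowerSum-suc n x) ⟩
    x * (x * (x + x * (x * X))) + x  ≡⟨ unfold x X ⟩
    x * (x * (x * (x * X) + x)) + x  ≡⟨ cong (λ u → x * (x * u) + x) (geometric n x) ⟩
    x * (x * (X + xᵖ)) + x           ≡⟨ fold x X xᵖ ⟩
    (x + x * (x * X)) + x * (x * xᵖ) ≡⟨ cong (_+ x * (x * xᵖ)) (oddPowerSum-suc n x) ⟨
    X′ + x * (x * xᵖ)                ∎
    where
    open ≡-Reasoning
    X = oddPowerSum n x
    X′ = oddPowerSum (suc n) x
    xᵖ = x ^ suc (double n)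
    unfold : ∀ x X → x * (x * (x + x * (x * X))) + x ≡ x * (x * (x * (x * X) + x)) + x
    unfold = solve-∀
    fold : ∀ x X y → x * (x * (X + y)) + x ≡ (x + x * (x * X)) + x * (x * y)
    fold = solve-∀

  -- Modulo the prime p = 2n + 1, multiplying X by x² does not change it: by the
  -- geometric-series identity and Fermat, x²·X + x = X + x^p ≡ X + x.
  oddPowerSum-fixed : ∀ {n} → Prime (suc (double n)) → ∀ x →
                      ∃[ q ] x * (x * oddPowerSum n x) ≡ oddPowerSum n x + q * suc (double n)
  oddPowerSum-fixed {n} pr x = from-fermat (fermat pr x)
    where
    open ≡-Reasoning
    p = suc (double n)
    X = oddPowerSum n x
    regroup : ∀ X x qp → X + (x + qp) ≡ (X + qp) + x
    regroup = solve-∀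
    from-fermat : ∃[ q ] x ^ p ≡ x + q * p → ∃[ q ] x * (x * X) ≡ X + q * p
    from-fermat (q , xᵖ≡) = q , +-cancelʳ-≡ x _ _ (begin
      x * (x * X) + x    ≡⟨ geometric n x ⟩
      X + x ^ p          ≡⟨ cong (X +_) xᵖ≡ ⟩
      X + (x + q * p)    ≡⟨ regroup X x (q * p) ⟩
      (X + q * p) + x    ∎)

  -- For 2 ≤ x ≤ p − 2 the odd power sum vanishes modulo p: writing x = y + 1,
  -- p divides (x² − 1)·X = y·(y + 2)·X but neither y nor y + 2.
  oddPowerSum-vanishes : ∀ {n x} → Prime (suc (double n)) → 2 ≤ x → suc x < suc (double n) →
                         suc (double n) ∣ oddPowerSum n x
  oddPowerSum-vanishes {n} {x@(suc y@(suc _))} pr (s≤s (s≤s z≤n)) y+2<p = vanish (oddPowerSum-fixed pr x)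
    where
    p = suc (double n)
    X = oddPowerSum n x
    y<p : y < p
    y<p = <-trans (n<1+n y) (<-trans (n<1+n x) y+2<p)
    expand : ∀ y X → y * ((2 + y) * X) + X ≡ suc y * (suc y * X)
    expand = solve-∀
    vanish : ∃[ q ] x * (x * X) ≡ X + q * p → p ∣ X
    vanish (q , x²X≡) = coprime-divisor (prime⇒coprime pr y+2<p) (coprime-divisor (prime⇒coprime pr y<p)
      (divides q (+-cancelʳ-≡ X (y * ((2 + y) * X)) (q * p) (trans (expand y X) (trans x²X≡ (+-comm X (q * p)))))))

  -- At the base x = p − 1 ≡ −1 each term x^(2i+1) ≡ −1, so X ≡ −n.
  suc∣odd-power+1 : ∀ x i → suc x ∣ x ^ suc (double i) + 1
  suc∣odd-power+1 x zero = divides 1 (base x)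
    where
    base : ∀ x → x * 1 + 1 ≡ 1 * suc x
    base = solve-∀
  suc∣odd-power+1 x (suc i) = ∣m+n∣m⇒∣n (subst (suc x ∣_) (identity x (x ^ suc (double i))) (m∣m*n _))
                                        (∣n⇒∣m*n x (suc∣odd-power+1 x i))
    where
    identity : ∀ x y → suc x * (x * y + 1) ≡ x * (y + 1) + (x * (x * y) + 1)
    identity = solve-∀

  oddPowerSum-at-minus-one : ∀ n → suc (double n) ∣ oddPowerSum n (double n) + n
  oddPowerSum-at-minus-one n = subst (suc (double n) ∣_) split
    (∣-sum {n = n} (λ i → double n ^ suc (double (toℕ i)) + 1) (λ i → suc∣odd-power+1 (double n) (toℕ i)))
    where
    split : ∑[ i < n ] (double n ^ suc (double (toℕ i)) + 1) ≡ oddPowerSum n (double n) + n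
    split = trans (∑-distrib-+ {n} (λ i → double n ^ suc (double (toℕ i))) (λ _ → 1)) (cong (oddPowerSum n (double n) +_) (∑-ones n))

  oddPowerSum-at-one : ∀ n → oddPowerSum n 1 ≡ n
  oddPowerSum-at-one n = trans (sum-cong-≗ {n} (λ i → ^-zeroˡ (suc (double (toℕ i))))) (∑-ones n)

  listSum-applyUpTo : ∀ (f g : ℕ → ℕ) n → listSum (map f (applyUpTo g n)) ≡ ∑[ i < n ] f (g (toℕ i))
  listSum-applyUpTo f g zero = refl
  listSum-applyUpTo f g (suc n) = cong (f (g 0) +_) (listSum-applyUpTo f (g ∘ suc) n)

  listSum-odd : ∀ (f h : ℕ → ℕ) m →
                (∀ i → h (double i) % 2 ≡ 0) → (∀ i → h (suc (double i)) % 2 ≡ 1) →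
                listSum (map f (filter (λ j → j % 2 ≟ 1) (applyUpTo h (double m))))
                  ≡ ∑[ i < m ] f (h (suc (double (toℕ i))))
  listSum-odd f h zero even odd = refl
  listSum-odd f h (suc m) even odd = begin
    listSum (map f (filter odd? (h 0 ∷ h 1 ∷ rest)))  ≡⟨ cong (listSum ∘ map f) (filter-reject odd? {h 0} {h 1 ∷ rest} h0-even) ⟩
    listSum (map f (filter odd? (h 1 ∷ rest)))        ≡⟨ cong (listSum ∘ map f) (filter-accept odd? {h 1} {rest} (odd 0)) ⟩
    f (h 1) + listSum (map f (filter odd? rest))      ≡⟨ cong (f (h 1) +_) (listSum-odd f (h ∘ suc ∘ suc) m (even ∘ suc) (odd ∘ suc)) ⟩
    f (h 1) + ∑[ i < m ] f (h (3 + double (toℕ i)))   ∎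
    where
    open ≡-Reasoning
    odd? : ∀ j → Dec (j % 2 ≡ 1)
    odd? j = j % 2 ≟ 1
    rest : List ℕ
    rest = applyUpTo (h ∘ suc ∘ suc) (double m)
    h0-even : h 0 % 2 ≢ 1
    h0-even h0-odd = 0≢1+n (trans (sym (even 0)) h0-odd)

  double%2 : ∀ i → double i % 2 ≡ 0
  double%2 i rewrite double-* i = m*n%n≡0 i 2

  suc-double%2 : ∀ i → suc (double i) % 2 ≡ 1
  suc-double%2 i rewrite double-* i = [m+kn]%n≡m%n 1 i 2

  double/2 : ∀ n → double n / 2 ≡ n
  double/2 n rewrite double-* n = m*n/n≡m n 2

  sumOdd-as-∑ : ∀ m f → sumOdd (suc (double (suc m)) ∸ 2) f ≡ ∑[ i < suc m ] f (suc (double (toℕ i)))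
  sumOdd-as-∑ m f = listSum-odd f id (suc m) double%2 suc-double%2

  S-as-∑ : ∀ n k → S (suc (double n)) k ≡ ∑[ a < n ] (suc (toℕ a) ^ k)
  S-as-∑ n k rewrite double/2 n = listSum-applyUpTo (λ a → suc a ^ k) id n

  T-as-∑ : ∀ n k → T (suc (double n)) k ≡ ∑[ a < n ] ((suc n + toℕ a) ^ k)
  T-as-∑ n k rewrite +-comm (double n) 1 | double/2 (suc n) | double-+ n | m+n∸m≡n n n
    = listSum-applyUpTo (λ a → (suc n + a) ^ k) id n

  sumOdd-S : ∀ m → sumOdd (suc (double (suc m)) ∸ 2) (S (suc (double (suc m))))
                     ≡ suc m + ∑[ a < m ] oddPowerSum (suc m) (2 + toℕ a)
  sumOdd-S m = begin
    sumOdd (p ∸ 2) (S p)                                         ≡⟨ sumOdd-as-∑ m (S p) ⟩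
    ∑[ i < n ] S p (suc (double (toℕ i)))                        ≡⟨ sum-cong-≗ {n} (λ i → S-as-∑ n (suc (double (toℕ i)))) ⟩
    ∑[ i < n ] ∑[ a < n ] (suc (toℕ a) ^ suc (double (toℕ i)))  ≡⟨ ∑-comm {n} {n} (λ i a → suc (toℕ a) ^ suc (double (toℕ i))) ⟩
    oddPowerSum n 1 + ∑[ a < m ] oddPowerSum n (2 + toℕ a)       ≡⟨ cong (_+ rest) (oddPowerSum-at-one n) ⟩
    n + ∑[ a < m ] oddPowerSum n (2 + toℕ a)                     ∎
    where
    open ≡-Reasoning
    n = suc m
    p = suc (double n)
    rest = ∑[ a < m ] oddPowerSum n (2 + toℕ a)

  ∣-sumOdd-S-rest : ∀ m → Prime (suc (double (suc m))) → suc (double (suc m)) ∣ ∑[ a < m ] oddPowerSum (suc m) (2 + toℕ a)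
  ∣-sumOdd-S-rest m pr = ∣-sum {n = m} _ λ a → oddPowerSum-vanishes pr (s≤s (s≤s z≤n)) (base<p a)
    where
    base<p : ∀ (a : Fin m) → suc (2 + toℕ a) < suc (double (suc m))
    base<p a = s<s (s<s (s<s (subst (toℕ a <_) (sym (double-+ m)) (<-≤-trans (toℕ<n a) (m≤m+n m m)))))

  sumOdd-T : ∀ m → sumOdd (suc (double (suc m)) ∸ 2) (T (suc (double (suc m))))
                     ≡ ∑[ a < m ] oddPowerSum (suc m) (2 + m + toℕ (inject₁ a)) + oddPowerSum (suc m) (double (suc m))
  sumOdd-T m = begin
    sumOdd (p ∸ 2) (T p)                                         ≡⟨ sumOdd-as-∑ m (T p) ⟩
    ∑[ i < n ] T p (suc (double (toℕ i)))                        ≡⟨ sum-cong-≗ {n} (λ i → T-as-∑ n (suc (double (toℕ i)))) ⟩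
    ∑[ i < n ] ∑[ a < n ] ((suc n + toℕ a) ^ suc (double (toℕ i))) ≡⟨ ∑-comm {n} {n} (λ i a → (suc n + toℕ a) ^ suc (double (toℕ i))) ⟩
    ∑[ a < n ] oddPowerSum n (suc n + toℕ a)                     ≡⟨ sum-init-last {m} (λ a → oddPowerSum n (suc n + toℕ a)) ⟩
    ∑[ a < m ] oddPowerSum n (suc n + toℕ (inject₁ a)) + oddPowerSum n (suc n + toℕ (fromℕ m))
      ≡⟨ cong (λ x → rest + oddPowerSum n x) last-base ⟩
    ∑[ a < m ] oddPowerSum n (suc n + toℕ (inject₁ a)) + oddPowerSum n (double n) ∎
    where
    open ≡-Reasoning
    n = suc m
    p = suc (double n)
    rest = ∑[ a < m ] oddPowerSum n (suc n + toℕ (inject₁ a))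
    last-base : suc n + toℕ (fromℕ m) ≡ double n
    last-base = begin
      suc n + toℕ (fromℕ m)  ≡⟨ cong (suc n +_) (toℕ-fromℕ m) ⟩
      suc (suc (m + m))      ≡⟨ cong (suc ∘ suc) (double-+ m) ⟨
      double n               ∎

  ∣-sumOdd-T+n : ∀ m → Prime (suc (double (suc m))) →
                 suc (double (suc m)) ∣ sumOdd (suc (double (suc m)) ∸ 2) (T (suc (double (suc m)))) + suc m
  ∣-sumOdd-T+n m pr = subst (p ∣_) (sym regroup)
    (∣m∣n⇒∣m+n (∣-sum {n = m} _ λ a → oddPowerSum-vanishes pr (s≤s (s≤s z≤n)) (base<p a))
               (oddPowerSum-at-minus-one n))
    where
    n = suc m
    p = suc (double n)
    rest = ∑[ a < m ] oddPowerSum n (2 + m + toℕ (inject₁ a))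
    regroup : sumOdd (p ∸ 2) (T p) + n ≡ rest + (oddPowerSum n (double n) + n)
    regroup = trans (cong (_+ n) (sumOdd-T m)) (+-assoc rest (oddPowerSum n (double n)) n)
    base<p : ∀ (a : Fin m) → suc (2 + m + toℕ (inject₁ a)) < p
    base<p a = s<s (s<s (s<s (subst (m + toℕ (inject₁ a) <_) (sym (double-+ m))
      (+-monoʳ-< m (subst (_< m) (sym (toℕ-inject₁ a)) (toℕ<n a))))))

module Halves where

  -- Transfer to ℤ: for p = 2n + 1 we have 2n ≡ −1, so N ≡ n means 2N + 1 ≡ 0
  -- (N ≡ −1/2) and N ≡ −n means 2N − 1 ≡ 0 (N ≡ 1/2) modulo p.

  open import Data.Nat as ℕ using (ℕ; suc)
  import Data.Nat.Divisibility as ℕ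
  open import Data.Integer using (+_; _*_; _+_; _-_)
  open import Data.Integer.Properties using (pos-+)
  open import Data.Integer.Divisibility using (_∣_)
  import Data.Integer.Divisibility.Signed as Signed
  open import Data.Integer.Tactic.RingSolver using (solve-∀)
  open import Relation.Binary.PropositionalEquality using (_≡_; refl; cong; subst; trans; module ≡-Reasoning)
  open PowerSums using (double; double-+)

  odd-as-ℤ : ∀ n → + suc (double n) ≡ + 1 + (+ n + + n)
  odd-as-ℤ n = trans (cong (λ k → + suc k) (double-+ n)) (trans (pos-+ 1 (n ℕ.+ n)) (cong (λ k → + 1 + k) (pos-+ n n)))

  minus-half : ∀ {n N D} → N ≡ n ℕ.+ D → suc (double n) ℕ.∣ D → + suc (double n) ∣ (+ 2) * (+ N) + + 1
  minus-half {n} {N} {D} refl p∣D =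
    Signed.∣⇒∣ᵤ (subst (+ p Signed.∣_) 2D+p≡2N+1 (Signed.∣m∣n⇒∣m+n (Signed.∣n⇒∣m*n (+ 2) (Signed.∣ᵤ⇒∣ {+ p} {+ D} p∣D)) Signed.∣-refl))
    where
    open ≡-Reasoning
    p = suc (double n)
    regroup : ∀ n D → + 2 * D + (+ 1 + (n + n)) ≡ + 2 * (n + D) + + 1
    regroup = solve-∀
    2D+p≡2N+1 : + 2 * + D + + p ≡ + 2 * + (n ℕ.+ D) + + 1
    2D+p≡2N+1 = begin
      + 2 * + D + + p                  ≡⟨ cong (λ k → + 2 * + D + k) (odd-as-ℤ n) ⟩
      + 2 * + D + (+ 1 + (+ n + + n))  ≡⟨ regroup (+ n) (+ D) ⟩
      + 2 * (+ n + + D) + + 1          ≡⟨ cong (λ u → + 2 * u + + 1) (pos-+ n D) ⟨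
      + 2 * + (n ℕ.+ D) + + 1          ∎

  plus-half : ∀ {n N} → suc (double n) ℕ.∣ N ℕ.+ n → + suc (double n) ∣ (+ 2) * (+ N) - + 1
  plus-half {n} {N} p∣N+n =
    Signed.∣⇒∣ᵤ (subst (+ p Signed.∣_) 2[N+n]-p≡2N-1 (Signed.∣m∣n⇒∣m-n (Signed.∣n⇒∣m*n (+ 2) (Signed.∣ᵤ⇒∣ {+ p} {+ (N ℕ.+ n)} p∣N+n)) Signed.∣-refl))
    where
    open ≡-Reasoning
    p = suc (double n)
    regroup : ∀ N n → + 2 * (N + n) - (+ 1 + (n + n)) ≡ + 2 * N - + 1
    regroup = solve-∀
    2[N+n]-p≡2N-1 : + 2 * + (N ℕ.+ n) - + p ≡ + 2 * + N - + 1
    2[N+n]-p≡2N-1 = begin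
      + 2 * + (N ℕ.+ n) - + p                  ≡⟨ cong (λ u → + 2 * u - + p) (pos-+ N n) ⟩
      + 2 * (+ N + + n) - + p                  ≡⟨ cong (λ u → + 2 * (+ N + + n) - u) (odd-as-ℤ n) ⟩
      + 2 * (+ N + + n) - (+ 1 + (+ n + + n))  ≡⟨ regroup (+ N) (+ n) ⟩
      + 2 * + N - + 1                          ∎

open PowerSums using (odd-prime; sumOdd-S; ∣-sumOdd-S-rest; ∣-sumOdd-T+n)
open Halves using (minus-half; plus-half)
open import Defs
open import Data.Nat using (ℕ; _∸_)
open import Relation.Binary.PropositionalEquality using (_≢_; refl)
open import Data.Nat.Primality using (Prime)
open import Data.Integer using (+_; _*_; _+_; _-_)
open import Data.Integer.Divisibility using (_∣_)
open import Data.Product using (_×_; _,_)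

theorem7 : (p : ℕ) → Prime p → p ≢ 2 →
    ((+ p) ∣ ((+ 2) * (+ sumOdd (p ∸ 2) (S p)) + + 1))
    × ((+ p) ∣ ((+ 2) * (+ sumOdd (p ∸ 2) (T p)) - + 1))
theorem7 p pr p≢2 with odd-prime pr p≢2
... | m , refl = minus-half (sumOdd-S m) (∣-sumOdd-S-rest m pr) , plus-half (∣-sumOdd-T+n m pr)
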